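{- If $3\leq n\leq 9$ and $n\neq 8$, then $d_0(C_n)=\Gamma_t(C_n)+1$.
   Context: $C_n$ is the cycle on $n$ vertices. A total dominating set (TDS) of a graph without isolated vertices is a vertex set $S$ such that every vertex is adjacent to a vertex of $S$; a minimal TDS is a TDS no proper subset of which is a TDS; $\Gamma_t(G)$ is the maximum cardinality of a minimal TDS. For a positive integer $k$, $D_k^t(G)$ is the graph whose vertices are the TDSs of $G$ of cardinality at most $k$, two being adjacent if and only if one is obtained from the other by adding or deleting a single vertex. $d_0(G)$ is the smallest integer $\ell$ such that $D_k^t(G)$ is connected for all $k\geq\ell$. -}

module Defs where

open import Data.Nat using (ℕ; zero; suc; _≤_; _<_)
open import Data.Fin using (Fin; toℕ)
open import Data.Fin.Subset using (Subset; _∈_; _∉_; _⊂_; ∣_∣; _∪_; ⁅_⁆)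
open import Data.Product using (Σ; ∃; _×_; _,_)
open import Data.Sum using (_⊎_)
open import Relation.Binary.PropositionalEquality using (_≡_)
open import Relation.Binary.Construct.Closure.ReflexiveTransitive using (Star)
open import Relation.Nullary using (¬_)

Graph : ℕ → Set₁
Graph n = Fin n → Fin n → Set

Cycle : (n : ℕ) → Graph n
Cycle n i j =
  (toℕ j ≡ suc (toℕ i)) ⊎ (toℕ i ≡ suc (toℕ j)) ⊎
  (toℕ i ≡ 0 × suc (toℕ j) ≡ n) ⊎ (toℕ j ≡ 0 × suc (toℕ i) ≡ n)

module _ {n : ℕ} (G : Graph n) where

  IsTDS : Subset n → Set
  IsTDS S = ∀ v → ∃ λ u → u ∈ S × G v u

  IsMinimalTDS : Subset n → Set
  IsMinimalTDS S = IsTDS S × (∀ S′ → S′ ⊂ S → ¬ IsTDS S′)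

  IsUpperTotalDomination : ℕ → Set
  IsUpperTotalDomination m =
    (∃ λ S → IsMinimalTDS S × ∣ S ∣ ≡ m) ×
    (∀ S → IsMinimalTDS S → ∣ S ∣ ≤ m)

  -- Vertices of D_k^t(G): TDSs of cardinality at most k.
  InD : ℕ → Subset n → Set
  InD k S = IsTDS S × ∣ S ∣ ≤ k

  OneStep : Subset n → Subset n → Set
  OneStep S T = (∃ λ v → v ∉ S × T ≡ S ∪ ⁅ v ⁆) ⊎ (∃ λ v → v ∉ T × S ≡ T ∪ ⁅ v ⁆)

  DEdge : ℕ → Subset n → Subset n → Set
  DEdge k S T = InD k S × InD k T × OneStep S T

  DConnected : ℕ → Set
  DConnected k = ∀ S T → InD k S → InD k T → Star (DEdge k) S T

  ConnectedFrom : ℕ → Set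
  ConnectedFrom ℓ = ∀ k → 1 ≤ k → ℓ ≤ k → DConnected k

  IsD0 : ℕ → Set
  IsD0 ℓ = 1 ≤ ℓ × ConnectedFrom ℓ × (∀ ℓ′ → 1 ≤ ℓ′ → ConnectedFrom ℓ′ → ℓ ≤ ℓ′)

-- Let Γ ≥ 1 bound the sizes of all minimal TDSs of G.
--  * A minimal TDS C with ∣C∣ = Γ is an isolated vertex of D_Γ: adding a
--    vertex exceeds the size bound, deleting one destroys total domination.
--    So D_Γ is disconnected as soon as it has a second vertex.
--  * A TDS with more than Γ vertices is not minimal, hence has a deletable
--    vertex; by repeated deletion every vertex of D_k (k > Γ) walks in D_k
--    down to D_{Γ+1}.  So connectivity of D_{Γ+1} gives it for all k > Γ.
-- Hence d₀(G) = Γ + 1 whenever D_Γ is disconnected and D_{Γ+1} connected.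
--
-- Minimality is decidable (a TDS is minimal iff no single vertex
-- is deletable), so Γₜ is decided by enumerating subsets.  Connectivity of
-- D_{Γ+1} is certified by a breadth-first search from a maximum minimal TDS
-- that records, for every vertex found, a walk back to the root; the
-- procedure  certifyD0  assembles everything and is run on each cycle.

module Submission where

open import Defs
open import Data.Bool.Properties using (∨-identityʳ) renaming (_≟_ to _≟B_)
open import Data.Empty using (⊥-elim)
open import Data.Fin using (Fin; toℕ; zero; suc)
open import Data.Fin.Properties using (all?; any?)
open import Data.Fin.Subset using (Subset; _∈_; _∉_; _⊂_; _⊆_; ∣_∣; _∪_; _─_; _-_; ⁅_⁆; ⊥; inside)
open import Data.Fin.Subset.Properties using (_∈?_; anySubset?; p⊆p∪q; x∈p∪q⁺; x∈⁅x⁆; p─⊥≡p; ∪-identityʳ; x∈p⇒p-x⊂p; x∈p⇒∣p-x∣<∣p∣; p⊂q⇒∣p∣<∣q∣; x∈p∧x≢y⇒x∈p-y)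
open import Data.List using (List; []; _∷_; [_]; _++_; mapMaybe; allFin)
open import Data.List.Relation.Unary.Any as Any using (Any; satisfied)
open import Data.Maybe using (Maybe; just; nothing; from-just; _>>=_)
open import Data.Nat using (ℕ; zero; suc; _≤_; _<_; _≤?_; _^_; z≤n; s≤s)
open import Data.Nat.Properties using (≤-refl; ≤-trans; ≤-reflexive; n≤1+n; <⇒≤; <⇒≱; ≰⇒>; ≮⇒≥; ≤-pred; <-≤-trans) renaming (_≟_ to _≟ℕ_)
open import Data.Product using (Σ; ∃; _×_; _,_; proj₁; proj₂)
open import Data.Sum using (inj₁; inj₂)
open import Data.Vec using (_∷_; here; there)
open import Data.Vec.Properties using (≡-dec)
open import Function using (_∘_; id)
open import Relation.Binary.Construct.Closure.ReflexiveTransitive using (Star; ε; _◅_; _◅◅_; reverse; gmap)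
open import Relation.Binary.PropositionalEquality using (_≡_; _≢_; refl; sym; trans; cong; cong₂)
open import Relation.Nullary using (¬_; Dec; yes; no; ¬?; contradiction)
open import Relation.Nullary.Decidable using (dec⇒maybe; map′; _×-dec_; _⊎-dec_; _→-dec_; decidable-stable)
open import Relation.Unary using (Decidable)

_≟S_ : ∀ {n} (S T : Subset n) → Dec (S ≡ T)
_≟S_ = ≡-dec _≟B_

allSubsets? : ∀ {n} {P : Subset n → Set} → Decidable P → Dec (∀ S → P S)
allSubsets? P? =
  map′ (λ noCounterexample S → decidable-stable (P? S) (λ ¬PS → noCounterexample (S , ¬PS)))
       (λ all (S , ¬PS) → ¬PS (all S))
       (¬? (anySubset? (¬? ∘ P?)))

x∉p-x : ∀ {n} (p : Subset n) x → x ∉ p - x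
x∉p-x (_ ∷ p) zero ()
x∉p-x (_ ∷ p) (suc x) (there x∈p-x) = x∉p-x p x x∈p-x

p-x∪⁅x⁆≡p : ∀ {n} {p : Subset n} {x} → x ∈ p → (p - x) ∪ ⁅ x ⁆ ≡ p
p-x∪⁅x⁆≡p {p = _ ∷ p} here = cong (inside ∷_) (trans (∪-identityʳ (p ─ ⊥)) (p─⊥≡p p))
p-x∪⁅x⁆≡p {p = b ∷ p} (there x∈p) = cong₂ _∷_ (∨-identityʳ b) (p-x∪⁅x⁆≡p x∈p)

p⊂p∪⁅x⁆ : ∀ {n} {p : Subset n} {x} → x ∉ p → p ⊂ p ∪ ⁅ x ⁆
p⊂p∪⁅x⁆ {x = x} x∉p = p⊆p∪q ⁅ x ⁆ , x , x∈p∪q⁺ (inj₂ (x∈⁅x⁆ x)) , x∉p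

module TotalDomination {n : ℕ} (G : Graph n) (adjacent? : ∀ u v → Dec (G u v)) where

  tds? : Decidable (IsTDS G)
  tds? S = all? λ v → any? λ u → (u ∈? S) ×-dec adjacent? v u

  inD? : ∀ k → Decidable (InD G k)
  inD? k S = tds? S ×-dec (∣ S ∣ ≤? k)

  tds-mono : ∀ {S T} → S ⊆ T → IsTDS G S → IsTDS G T
  tds-mono S⊆T tdsS v with tdsS v
  ... | u , u∈S , vu = u , S⊆T u∈S , vu

  Deletable : Subset n → Fin n → Set
  Deletable S x = x ∈ S × IsTDS G (S - x)

  deletable? : ∀ S → Decidable (Deletable S)
  deletable? S x = (x ∈? S) ×-dec tds? (S - x)

  minimal⇒no-deletable : ∀ {S} → IsMinimalTDS G S → ∀ x → ¬ Deletable S x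
  minimal⇒no-deletable {S} (_ , noSmaller) x (x∈S , tdsS-x) = noSmaller (S - x) (x∈p⇒p-x⊂p x∈S) tdsS-x

  -- Conversely minimality only needs to be tested one vertex at a time: if a
  -- proper subset S′ of S is a TDS, so is its superset S - x for x ∈ S ∖ S′.
  no-deletable⇒minimal : ∀ {S} → IsTDS G S → (∀ x → ¬ Deletable S x) → IsMinimalTDS G S
  no-deletable⇒minimal tdsS noDeletable = tdsS , λ { S′ (S′⊆S , x , x∈S , x∉S′) tdsS′ →
    noDeletable x (x∈S , tds-mono (λ y∈S′ → x∈p∧x≢y⇒x∈p-y (S′⊆S y∈S′) (λ { refl → x∉S′ y∈S′ })) tdsS′) }

  minimal? : Decidable (IsMinimalTDS G)
  minimal? S with tds? S
  ... | no ¬tds = no (¬tds ∘ proj₁)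
  ... | yes tdsS = map′ (no-deletable⇒minimal tdsS) minimal⇒no-deletable (all? λ x → ¬? (deletable? S x))

  MinimalBound : ℕ → Set
  MinimalBound Γ = ∀ S → IsMinimalTDS G S → ∣ S ∣ ≤ Γ

  deletable-above : ∀ {Γ S} → MinimalBound Γ → IsTDS G S → Γ < ∣ S ∣ → ∃ (Deletable S)
  deletable-above {Γ} {S} bound tdsS Γ<∣S∣ with any? (deletable? S)
  ... | yes deletable = deletable
  ... | no none = contradiction (bound S (no-deletable⇒minimal tdsS λ x d → none (x , d))) (<⇒≱ Γ<∣S∣)

  deletion-step : ∀ {S x} → x ∈ S → OneStep G (S - x) S
  deletion-step {S} {x} x∈S = inj₁ (x , x∉p-x S x , sym (p-x∪⁅x⁆≡p x∈S))

  insertion-step : ∀ {S x} → x ∉ S → OneStep G (S ∪ ⁅ x ⁆) S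
  insertion-step {x = x} x∉S = inj₂ (x , x∉S , refl)

  DEdge-sym : ∀ {k S T} → DEdge G k S T → DEdge G k T S
  DEdge-sym (S∈D , T∈D , inj₁ step) = T∈D , S∈D , inj₂ step
  DEdge-sym (S∈D , T∈D , inj₂ step) = T∈D , S∈D , inj₁ step

  -- D_k is an induced subgraph of D_k′ for k ≤ k′, so walks lift.
  walk-mono : ∀ {k k′} → k ≤ k′ → ∀ {S T} → Star (DEdge G k) S T → Star (DEdge G k′) S T
  walk-mono k≤k′ = gmap id λ ((tdsS , ∣S∣≤k) , (tdsT , ∣T∣≤k) , step) →
    (tdsS , ≤-trans ∣S∣≤k k≤k′) , (tdsT , ≤-trans ∣T∣≤k k≤k′) , step

  minimal-isolated : ∀ {k C X} → IsMinimalTDS G C → ∣ C ∣ ≡ k → ¬ DEdge G k C X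
  minimal-isolated _ refl (_ , (_ , ∣X∣≤∣C∣) , inj₁ (v , v∉C , refl)) = <⇒≱ (p⊂q⇒∣p∣<∣q∣ (p⊂p∪⁅x⁆ v∉C)) ∣X∣≤∣C∣
  minimal-isolated (_ , noSmaller) _ (_ , (tdsX , _) , inj₂ (v , v∉X , refl)) = noSmaller _ (p⊂p∪⁅x⁆ v∉X) tdsX

  minimal-disconnects : ∀ {k C T} → IsMinimalTDS G C → ∣ C ∣ ≡ k → InD G k T → T ≢ C → ¬ DConnected G k
  minimal-disconnects {C = C} {T} minC ∣C∣≡k T∈D T≢C connected
    with connected C T (proj₁ minC , ≤-reflexive ∣C∣≡k) T∈D
  ... | ε = T≢C refl
  ... | edge ◅ _ = minimal-isolated minC ∣C∣≡k edge

  -- Above the bound, repeated deletion walks any vertex of D_k into D_{Γ+1};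
  -- m bounds ∣S∣ and decreases with every deletion.
  descend : ∀ {Γ k} → MinimalBound Γ → ∀ m S → IsTDS G S → ∣ S ∣ ≤ m → ∣ S ∣ ≤ k →
    ∃ λ S′ → InD G (suc Γ) S′ × Star (DEdge G k) S S′
  descend {Γ} bound m S tdsS ∣S∣≤m ∣S∣≤k with ∣ S ∣ ≤? suc Γ
  ... | yes small = S , (tdsS , small) , ε
  ... | no large with m | deletable-above bound tdsS (<⇒≤ (≰⇒> large))
  ...   | zero  | _ = contradiction (≤-trans ∣S∣≤m z≤n) large
  ...   | suc m′ | x , x∈S , tdsS-x =
    let shrinks = x∈p⇒∣p-x∣<∣p∣ x∈S
        ∣S-x∣≤k = <⇒≤ (<-≤-trans shrinks ∣S∣≤k)
        deletion = DEdge-sym ((tdsS-x , ∣S-x∣≤k) , (tdsS , ∣S∣≤k) , deletion-step x∈S)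
        (S′ , S′∈D , walk) = descend bound m′ (S - x) tdsS-x (≤-pred (<-≤-trans shrinks ∣S∣≤m)) ∣S-x∣≤k
    in S′ , S′∈D , deletion ◅ walk

  connected-above : ∀ {Γ} → MinimalBound Γ → DConnected G (suc Γ) → ConnectedFrom G (suc Γ)
  connected-above bound connected k _ Γ<k S T (tdsS , ∣S∣≤k) (tdsT , ∣T∣≤k) =
    let (S′ , S′∈D , S→S′) = descend bound ∣ S ∣ S tdsS ≤-refl ∣S∣≤k
        (T′ , T′∈D , T→T′) = descend bound ∣ T ∣ T tdsT ≤-refl ∣T∣≤k
    in S→S′ ◅◅ walk-mono Γ<k (connected S′ T′ S′∈D T′∈D) ◅◅ reverse DEdge-sym T→T′

  d0-criterion : ∀ {Γ} → MinimalBound Γ → 1 ≤ Γ → ¬ DConnected G Γ → DConnected G (suc Γ) → IsD0 G (suc Γ)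
  d0-criterion {Γ} bound 1≤Γ disconnected connected = s≤s z≤n , connected-above bound connected , least
    where
    least : ∀ ℓ′ → 1 ≤ ℓ′ → ConnectedFrom G ℓ′ → suc Γ ≤ ℓ′
    least ℓ′ _ connectedFrom with suc Γ ≤? ℓ′
    ... | yes Γ<ℓ′ = Γ<ℓ′
    ... | no Γ≮ℓ′ = contradiction (connectedFrom Γ 1≤Γ (≮⇒≥ Γ≮ℓ′)) disconnected

  -- It is only used as a certificate: if it
  -- finds every vertex of D_k, then D_k is connected.
  module Search (k : ℕ) (C : Subset n) (C∈D : InD G k C) where

    Reached : Set
    Reached = Σ (Subset n) λ S → InD G k S × Star (DEdge G k) S C

    toggle : (S : Subset n) (v : Fin n) → ∃ λ T → OneStep G T S
    toggle S v with v ∈? S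
    ... | yes v∈S = S - v , deletion-step v∈S
    ... | no v∉S = S ∪ ⁅ v ⁆ , insertion-step v∉S

    extend : Reached → Fin n → Maybe Reached
    extend (S , S∈D , walk) v with toggle S v
    ... | T , step with inD? k T
    ...   | yes T∈D = just (T , T∈D , (T∈D , S∈D , step) ◅ walk)
    ...   | no _ = nothing

    neighbours : Reached → List Reached
    neighbours r = mapMaybe (extend r) (allFin n)

    fresh : List Reached → List Reached → List Reached
    fresh seen [] = []
    fresh seen (r ∷ rs) with Any.any? (λ s → proj₁ s ≟S proj₁ r) seen
    ... | yes _ = fresh seen rs
    ... | no _ = r ∷ fresh (r ∷ seen) rs

    -- Process the queue; every set enters it at most once, so 2ⁿ rounds suffice.
    explore : ℕ → List Reached → List Reached → List Reached
    explore zero found queue = found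
    explore (suc rounds) found [] = found
    explore (suc rounds) found (r ∷ queue) = continue (fresh found (neighbours r))
      where continue : List Reached → List Reached
            continue new = explore rounds (found ++ new) (queue ++ new)

    reached : List Reached
    reached = explore (2 ^ n) [ C , C∈D , ε ] [ C , C∈D , ε ]

    Covers : List Reached → Set
    Covers rs = ∀ S → InD G k S → Any (λ r → proj₁ r ≡ S) rs

    covers? : ∀ rs → Dec (Covers rs)
    covers? rs = allSubsets? λ S → inD? k S →-dec Any.any? (λ r → proj₁ r ≟S S) rs

    covers⇒connected : ∀ {rs} → Covers rs → DConnected G k
    covers⇒connected covers S T S∈D T∈D = toRoot S S∈D ◅◅ reverse DEdge-sym (toRoot T T∈D)
      where toRoot : ∀ S → InD G k S → Star (DEdge G k) S C
            toRoot S S∈D with satisfied (covers S S∈D)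
            ... | (_ , _ , walk) , refl = walk

  root∈D : ∀ {Γ C} → IsMinimalTDS G C → ∣ C ∣ ≡ Γ → InD G (suc Γ) C
  root∈D {Γ} minC ∣C∣≡Γ = proj₁ minC , ≤-trans (≤-reflexive ∣C∣≡Γ) (n≤1+n Γ)

  certifyD0 : (Γ : ℕ) → Maybe (IsUpperTotalDomination G Γ × IsD0 G (suc Γ))
  certifyD0 Γ = do
    1≤Γ ← dec⇒maybe (1 ≤? Γ)
    (C , minC , ∣C∣≡Γ) ← dec⇒maybe (anySubset? (λ S → minimal? S ×-dec (∣ S ∣ ≟ℕ Γ)))
    bound ← dec⇒maybe (allSubsets? (λ S → minimal? S →-dec (∣ S ∣ ≤? Γ)))
    (T , T∈D , T≢C) ← dec⇒maybe (anySubset? (λ T → inD? Γ T ×-dec ¬? (T ≟S C)))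
    let open Search (suc Γ) C (root∈D minC ∣C∣≡Γ)
    covers ← dec⇒maybe (covers? reached)
    just (((C , minC , ∣C∣≡Γ) , bound) ,
          d0-criterion bound 1≤Γ (minimal-disconnects minC ∣C∣≡Γ T∈D T≢C) (covers⇒connected covers))

cycle-adjacent? : ∀ n (i j : Fin n) → Dec (Cycle n i j)
cycle-adjacent? n i j =
  (toℕ j ≟ℕ suc (toℕ i)) ⊎-dec (toℕ i ≟ℕ suc (toℕ j)) ⊎-dec
  ((toℕ i ≟ℕ 0) ×-dec (suc (toℕ j) ≟ℕ n)) ⊎-dec ((toℕ j ≟ℕ 0) ×-dec (suc (toℕ i) ≟ℕ n))

certifyCycle : ∀ n Γ → Maybe (IsUpperTotalDomination (Cycle n) Γ × IsD0 (Cycle n) (suc Γ))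
certifyCycle n = TotalDomination.certifyD0 (Cycle n) (cycle-adjacent? n)

lemma3p8 : (n : ℕ) → 3 ≤ n → n ≤ 9 → n ≢ 8 →
    ∃ λ γ → IsUpperTotalDomination (Cycle n) γ × IsD0 (Cycle n) (suc γ)
lemma3p8 3 _ _ _ = 2 , from-just (certifyCycle 3 2)
lemma3p8 4 _ _ _ = 2 , from-just (certifyCycle 4 2)
lemma3p8 5 _ _ _ = 3 , from-just (certifyCycle 5 3)
lemma3p8 6 _ _ _ = 4 , from-just (certifyCycle 6 4)
lemma3p8 7 _ _ _ = 4 , from-just (certifyCycle 7 4)
lemma3p8 8 _ _ 8≢8 = ⊥-elim (8≢8 refl)
lemma3p8 9 _ _ _ = 6 , from-just (certifyCycle 9 6)
lemma3p8 0 () _ _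
lemma3p8 1 (s≤s ()) _ _
lemma3p8 2 (s≤s (s≤s ())) _ _
lemma3p8 (suc (suc (suc (suc (suc (suc (suc (suc (suc (suc _)))))))))) _ (s≤s (s≤s (s≤s (s≤s (s≤s (s≤s (s≤s (s≤s (s≤s ()))))))))) _
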